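{- Let $\Pi_{42}$ be the map on $\mathbb{N}=\{1,2,3,\dots\}$ produced by: at step $1$ set $\Pi_{42}(1)=1$; for $m=2,3,\dots$ in turn, at step $m$, if $\Pi_{42}(m-\lfloor (m+1)/2\rfloor)$ has not been assigned earlier set $\Pi_{42}(m-\lfloor (m+1)/2\rfloor)=m$, otherwise set $\Pi_{42}(m+\lfloor (m+1)/2\rfloor)=m$. Let $I_4(1)<I_4(2)<\cdots$ be the increasing enumeration of the set $\{1\}\cup\{n\in\mathbb{N}:\Pi_{42}(n)\text{ has type (IV)}\}$. Let $\kappa$ be the morphism on $\{1,2,3,4\}^*$ given by $\kappa(1)=12$, $\kappa(2)=123$, $\kappa(3)=1233$, $\kappa(4)=423$, let $k=k(1)k(2)\dots=4231231233\dots$ be its fixed point starting with $4$, and let $\lambda$ be the letter-to-letter map $1\mapsto3$, $2\mapsto6$, $3\mapsto9$, $4\mapsto6$. Then for all $n\ge1$, $I_4(n+2)-I_4(n+1)=\lambda(k(n))$.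
   Context: The procedure assigns a value $\Pi_{42}(n)$ to every $n\in\mathbb{N}$. $\Pi_{42}(n)$ has type (IV) if $\Pi_{42}(n)<n$ and $\Pi_{42}(n)=2n/3$. (The paper writes the conclusion as $\Delta I_4(n+1)=\lambda(k(n))$ for $n\ge1$, with $\Delta x(j)=x(j+1)-x(j)$.) -}

module Defs where

open import Data.Nat using (ℕ; zero; suc; _+_; _*_; _∸_; _≡ᵇ_; _<_; _≤_)
open import Data.Nat.DivMod using (_/_)
open import Data.Maybe using (Maybe; just; nothing)
open import Data.Bool using (if_then_else_)
open import Data.List using (List; []; _∷_; concatMap)
open import Data.Product using (∃; _×_; _,_)
open import Relation.Binary.PropositionalEquality using (_≡_)

State : Set
State = ℕ → Maybe ℕ

empty : State
empty _ = nothing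

assign : State → ℕ → ℕ → State
assign s p v q = if q ≡ᵇ p then just v else s q

stepAt : ℕ → State → State
stepAt m s with s (m ∸ ((m + 1) / 2))
... | nothing = assign s (m ∸ ((m + 1) / 2)) m
... | just _  = assign s (m + ((m + 1) / 2)) m

state : ℕ → State
state zero = empty
state (suc zero) = assign empty 1 1
state (suc (suc k)) = stepAt (suc (suc k)) (state (suc k))

-- Position n can only be written at steps m with
-- m ∸ ⌊(m+1)/2⌋ = ⌊m/2⌋ = n (so m ≤ 2n+1) or m + ⌊(m+1)/2⌋ = n (so m < n);
-- hence state (2n+1) already holds the final value of position n.
Π₄₂ : ℕ → Maybe ℕ
Π₄₂ n = state (2 * n + 1) n

TypeIV : ℕ → Set
TypeIV n = ∃ λ v → Π₄₂ n ≡ just v × v < n × 3 * v ≡ 2 * n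

data InS (n : ℕ) : Set where
  one  : n ≡ 1 → InS n
  typ4 : 1 ≤ n → TypeIV n → InS n

data Letter : Set where
  a1 a2 a3 a4 : Letter

κ : Letter → List Letter
κ a1 = a1 ∷ a2 ∷ []
κ a2 = a1 ∷ a2 ∷ a3 ∷ []
κ a3 = a1 ∷ a2 ∷ a3 ∷ a3 ∷ []
κ a4 = a4 ∷ a2 ∷ a3 ∷ []

κ* : List Letter → List Letter
κ* = concatMap κ

κ^ : ℕ → List Letter
κ^ zero = a4 ∷ []
κ^ (suc j) = κ* (κ^ j)

nth : List Letter → ℕ → Letter
nth [] _ = a4
nth (x ∷ xs) zero = x
nth (x ∷ xs) (suc i) = nth xs i

-- k(n) (1-based): the fixed point of κ starting with 4 is the limit of
-- κ^j(4); κ^j(4) is a prefix of κ^(j+1)(4) and has length ≥ 2^j ≥ j+1 > n-1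
-- for j = n, so k(n) = the n-th letter of κ^n(4).
k : ℕ → Letter
k n = nth (κ^ n) (n ∸ 1)

lam : Letter → ℕ
lam a1 = 3
lam a2 = 6
lam a3 = 9
lam a4 = 6

module Submission where

-- The *marked* numbers are 1, every 3q+2 with q ≥ 1, and every
-- 3q with q marked.  Then:
--  (1) Π₄₂(p) has an explicit closed form `writeTime p` (2p for unmarked p,
--      2q for a marked p = 3q, …): we show by induction on the steps that the
--      partial assignment after m steps reveals exactly the cells with write
--      time ≤ m, each step writing the unique cell with that write time;
--  (2) hence p has type (IV) iff p = 3q with q marked;
--  (3) coding a letter x by a mark followed by gap(x) unmarked positions,
--      the code of κ^J(4) is an initial window of the marks, since κ and the
--      self-similarity  marks = 10·expand(marks)  (b ↦ b01) correspond;
--  (4) so the marked numbers are enumerated by markPos, with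
--      markPos(t+1) − markPos(t) = width(k(t+1)), and I = 1, 3·markPos(0), …
--      enumerates {1} ∪ {type (IV)} with gaps 3·width(k(n)) = λ(k(n)).

open import Defs
open import Data.Nat using (ℕ; zero; suc; _+_; _*_; _∸_; _≡ᵇ_; _≤_; _<_; _≤?_; _≟_; z≤n; s≤s)
open import Data.Nat.Properties
open import Data.Nat.DivMod using (_/_; m/n≡1+[m∸n]/n)
open import Data.Nat.Tactic.RingSolver using (solve-∀)
open import Data.Bool using (Bool; true; false; if_then_else_)
open import Data.Maybe using (Maybe; just; nothing)
open import Data.List using (List; []; _∷_; _++_; _∷ʳ_; [_]; concatMap; replicate; length)
open import Data.List.Properties using (++-assoc; ++-identityʳ; length-++; concatMap-++; ∷ʳ-injective; ∷-injective; ∷-injectiveˡ)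
open import Data.List.Relation.Unary.All using (All; []; _∷_)
open import Data.Product using (∃; _×_; _,_; proj₁; proj₂)
open import Data.Maybe.Properties using (just-injective)
open import Function.Bundles using (_⇔_; mk⇔)
open import Function.Properties.Equivalence using () renaming (sym to ⇔-sym; trans to ⇔-trans)
open import Data.Sum using (_⊎_; inj₁; inj₂)
open import Data.Unit using (tt)
open import Relation.Nullary using (yes; no; ¬_; contradiction)
open import Relation.Binary.PropositionalEquality hiding ([_])

odd≢even : ∀ a b → suc (a * 2) ≢ b * 2
odd≢even zero zero ()
odd≢even zero (suc b) ()
odd≢even (suc a) zero ()
odd≢even (suc a) (suc b) e = odd≢even a b (suc-injective (suc-injective e))

data Parity : ℕ → Set where
  even : ∀ j → Parity (j * 2)
  odd  : ∀ j → Parity (suc (j * 2))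

parity : ∀ n → Parity n
parity zero = even 0
parity (suc n) with parity n
... | even j = odd j
... | odd j = even (suc j)

stepwise-increasing : ∀ (g : ℕ → ℕ) b → (∀ i → b ≤ i → g i < g (suc i)) → ∀ i j → b ≤ i → i < j → g i < g j
stepwise-increasing g b step i (suc j) b≤i (s≤s i≤j) with m≤n⇒m<n∨m≡n i≤j
... | inj₁ i<j = <-trans (stepwise-increasing g b step i j b≤i i<j) (step j (≤-trans b≤i i≤j))
... | inj₂ refl = step i b≤i

bracket : ∀ (g : ℕ → ℕ) → (∀ t → g t < g (suc t)) → ∀ d → g 0 ≤ d → ∃ λ t → g t ≤ d × d < g (suc t)
bracket g increasing zero g0≤0 = 0 , g0≤0 , ≤-<-trans z≤n (increasing 0)
bracket g increasing (suc d) g0≤1+d with m≤n⇒m<n∨m≡n g0≤1+d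
... | inj₂ g0≡1+d = 0 , g0≤1+d , subst (_< g 1) g0≡1+d (increasing 0)
... | inj₁ g0<1+d with bracket g increasing d (≤-pred g0<1+d)
...   | t , gt≤d , d<gt+1 with m≤n⇒m<n∨m≡n d<gt+1
...     | inj₁ 1+d<gt+1 = t , m≤n⇒m≤1+n gt≤d , 1+d<gt+1
...     | inj₂ 1+d≡gt+1 =
  suc t , ≤-reflexive (sym 1+d≡gt+1) , subst (_< g (suc (suc t))) (sym 1+d≡gt+1) (increasing (suc t))

gapless-enumeration : ∀ (g : ℕ → ℕ) (P : ℕ → Set) → (∀ t → g t < g (suc t)) →
                      (∀ t d → g t < d → d < g (suc t) → ¬ P d) →
                      ∀ d → g 0 ≤ d → P d → ∃ λ t → g t ≡ d
gapless-enumeration g P increasing gaps d g0≤d Pd with bracket g increasing d g0≤d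
... | t , gt≤d , d<gt+1 with m≤n⇒m<n∨m≡n gt≤d
...   | inj₁ gt<d = contradiction Pd (gaps t d gt<d d<gt+1)
...   | inj₂ gt≡d = t , gt≡d

nth-++ : ∀ xs ys i → i < length xs → nth (xs ++ ys) i ≡ nth xs i
nth-++ (x ∷ xs) ys zero _ = refl
nth-++ (x ∷ xs) ys (suc i) (s≤s i<∣xs∣) = nth-++ xs ys i i<∣xs∣

data Ternary : ℕ → Set where
  zero₃ : Ternary 0
  one₃  : Ternary 1
  two₃  : Ternary 2
  3[1+_]   : ∀ q → Ternary (suc q * 3)
  3[1+_]+1 : ∀ q → Ternary (suc (suc q * 3))
  3[1+_]+2 : ∀ q → Ternary (suc (suc (suc q * 3)))

ternary-suc : ∀ {n} → Ternary n → Ternary (suc n)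
ternary-suc zero₃ = one₃
ternary-suc one₃ = two₃
ternary-suc two₃ = 3[1+ 0 ]
ternary-suc 3[1+ q ] = 3[1+ q ]+1
ternary-suc 3[1+ q ]+1 = 3[1+ q ]+2
ternary-suc 3[1+ q ]+2 = 3[1+ suc q ]

ternary : ∀ n → Ternary n
ternary zero = zero₃
ternary (suc n) = ternary-suc (ternary n)

ternary-3[1+] : ∀ q → ternary (suc q * 3) ≡ 3[1+ q ]
ternary-3[1+] zero = refl
ternary-3[1+] (suc q) = cong (λ t → ternary-suc (ternary-suc (ternary-suc t))) (ternary-3[1+] q)

ternary-3[1+]+1 : ∀ q → ternary (suc (suc q * 3)) ≡ 3[1+ q ]+1
ternary-3[1+]+1 q = cong ternary-suc (ternary-3[1+] q)

ternary-3[1+]+2 : ∀ q → ternary (suc (suc (suc q * 3))) ≡ 3[1+ q ]+2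
ternary-3[1+]+2 q = cong ternary-suc (ternary-3[1+]+1 q)

-- The marked numbers: 1, every 3q+2 with q ≥ 1, and 3q whenever q is marked.
-- (They are the positions p that get assigned before step 2p.)  The
-- recursion 3q ↦ q is not structural, so it is evaluated with `fuel`
-- unfoldings, which suffices as soon as the argument is below the fuel.
mutual
  markedWithin : ℕ → ℕ → Bool
  markedWithin zero _ = false
  markedWithin (suc fuel) n = markedᵛ fuel (ternary n)

  markedᵛ : ℕ → ∀ {n} → Ternary n → Bool
  markedᵛ fuel zero₃ = false
  markedᵛ fuel one₃ = true
  markedᵛ fuel two₃ = false
  markedᵛ fuel 3[1+ q ] = markedWithin fuel (suc q)
  markedᵛ fuel 3[1+ q ]+1 = false
  markedᵛ fuel 3[1+ q ]+2 = true

marked : ℕ → Bool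
marked n = markedWithin (suc n) n

1+q<3[1+q] : ∀ q → suc q < suc q * 3
1+q<3[1+q] q = s≤s (s≤s (m≤n⇒m≤1+n (m≤m*n q 3)))

2+q≤3[1+q]+2 : ∀ q → suc (suc q) ≤ suc (suc (suc q * 3))
2+q≤3[1+q]+2 q = s≤s (m≤n⇒m≤1+n (m≤m*n (suc q) 3))

markedWithin-stable : ∀ f g n → n < f → n < g → markedWithin f n ≡ markedWithin g n
markedWithin-stable (suc f) (suc g) n (s≤s n≤f) (s≤s n≤g) with ternary n
... | zero₃ = refl
... | one₃ = refl
... | two₃ = refl
... | 3[1+ q ] = markedWithin-stable f g (suc q) (<-≤-trans (1+q<3[1+q] q) n≤f) (<-≤-trans (1+q<3[1+q] q) n≤g)
... | 3[1+ q ]+1 = refl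
... | 3[1+ q ]+2 = refl

markedWithin-3[1+] : ∀ q → markedWithin (suc q * 3) (suc q) ≡ marked (suc q)
markedWithin-3[1+] q = markedWithin-stable (suc q * 3) (suc (suc q)) (suc q) (1+q<3[1+q] q) ≤-refl

marked-3[1+] : ∀ q → marked (suc q * 3) ≡ marked (suc q)
marked-3[1+] q = trans (cong (markedᵛ (suc q * 3)) (ternary-3[1+] q)) (markedWithin-3[1+] q)

marked-3[1+]+1 : ∀ q → marked (suc (suc q * 3)) ≡ false
marked-3[1+]+1 q = cong (markedᵛ (suc (suc q * 3))) (ternary-3[1+]+1 q)

marked-3[1+]+2 : ∀ q → marked (suc (suc (suc q * 3))) ≡ true
marked-3[1+]+2 q = cong (markedᵛ (suc (suc (suc q * 3)))) (ternary-3[1+]+2 q)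

-- The step at which the procedure assigns position p, in closed form: an
-- unmarked p is written at step 2p, a marked 3(q+1) at step 2(q+1), and
-- 3(q+1)+2 at step 2(q+1)+1.
writeTimeᵛ : ∀ {p} → Ternary p → ℕ
writeTimeᵛ zero₃ = 0
writeTimeᵛ one₃ = 1
writeTimeᵛ two₃ = 4
writeTimeᵛ 3[1+ q ] = if marked (suc q) then suc q * 2 else suc q * 3 * 2
writeTimeᵛ 3[1+ q ]+1 = suc (suc q * 3) * 2
writeTimeᵛ 3[1+ q ]+2 = suc (suc q * 2)

writeTime : ℕ → ℕ
writeTime p = writeTimeᵛ (ternary p)

writeTime-marked-3[1+] : ∀ q → marked (suc q) ≡ true → writeTime (suc q * 3) ≡ suc q * 2
writeTime-marked-3[1+] q m = begin
  writeTimeᵛ (ternary (suc q * 3))                        ≡⟨ cong writeTimeᵛ (ternary-3[1+] q) ⟩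
  (if marked (suc q) then suc q * 2 else suc q * 3 * 2)  ≡⟨ cong (λ b → if b then suc q * 2 else suc q * 3 * 2) m ⟩
  suc q * 2                                               ∎
  where open ≡-Reasoning

writeTime-3[1+]+2 : ∀ q → writeTime (suc (suc (suc q * 3))) ≡ suc (suc q * 2)
writeTime-3[1+]+2 q = cong writeTimeᵛ (ternary-3[1+]+2 q)

writeTime-unmarked : ∀ p → marked p ≡ false → writeTime p ≡ p * 2
writeTime-unmarked p m with ternary p
... | zero₃ = refl
... | two₃ = refl
... | 3[1+ q ]+1 = refl
... | 3[1+ q ] rewrite markedWithin-3[1+] q | m = refl

-- No position is written later than twice its index, and a marked one strictly
-- earlier; so at step 2p (resp. 2p+1) position p has already been assigned
-- exactly when p is marked (resp. always).
writeTime-≤ : ∀ p → writeTime p ≤ p * 2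
writeTime-≤ p with ternary p
... | zero₃ = z≤n
... | one₃ = s≤s z≤n
... | two₃ = ≤-refl
... | 3[1+ q ] with marked (suc q)
...   | true = *-monoˡ-≤ 2 (<⇒≤ (1+q<3[1+q] q))
...   | false = ≤-refl
writeTime-≤ p | 3[1+ q ]+1 = ≤-refl
writeTime-≤ p | 3[1+ q ]+2 = ≤-trans (n≤1+n _) (*-monoˡ-≤ 2 (2+q≤3[1+q]+2 q))

writeTime-marked-< : ∀ p → marked p ≡ true → writeTime p < p * 2
writeTime-marked-< p m with ternary p
... | one₃ = s≤s (s≤s z≤n)
... | 3[1+ q ] rewrite markedWithin-3[1+] q | m = *-monoˡ-< 2 (1+q<3[1+q] q)
... | 3[1+ q ]+2 = <-≤-trans (n<1+n _) (*-monoˡ-≤ 2 (2+q≤3[1+q]+2 q))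

-- Each step M ≥ 1 writes exactly one position, which the following three
-- lemmas identify: step 1 writes 1, step 2j writes j or 3j according as j is
-- unmarked or marked, and step 2j+1 (j ≥ 1) writes 3j+2.
writeTime≡1 : ∀ p → writeTime p ≡ 1 → p ≡ 1
writeTime≡1 p e with ternary p
writeTime≡1 p refl | one₃ = refl
writeTime≡1 p e | 3[1+ q ] with marked (suc q)
writeTime≡1 p () | 3[1+ q ] | true
writeTime≡1 p () | 3[1+ q ] | false

writeTime≡even : ∀ j p → writeTime p ≡ suc j * 2 →
                 (marked p ≡ false × p ≡ suc j) ⊎ (marked (suc j) ≡ true × p ≡ suc j * 3)
writeTime≡even j p e with ternary p
... | two₃ = inj₁ (refl , *-cancelʳ-≡ 2 (suc j) 2 e)
... | 3[1+ q ]+1 = inj₁ (refl , *-cancelʳ-≡ _ (suc j) 2 e)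
... | 3[1+ q ]+2 = contradiction e (odd≢even (suc q) (suc j))
... | 3[1+ q ] rewrite markedWithin-3[1+] q with marked (suc q) in m
...   | true = inj₂ (subst (λ i → marked i ≡ true) q≡j m , cong (_* 3) q≡j)
  where q≡j = *-cancelʳ-≡ (suc q) (suc j) 2 e
...   | false = inj₁ (refl , *-cancelʳ-≡ _ (suc j) 2 e)

writeTime≡odd : ∀ j p → writeTime p ≡ suc (suc j * 2) → p ≡ suc (suc (suc j * 3))
writeTime≡odd j p e with ternary p
... | two₃ = contradiction (sym e) (odd≢even (suc j) 2)
... | 3[1+ q ]+1 = contradiction (sym e) (odd≢even (suc j) (suc (suc q * 3)))
... | 3[1+ q ]+2 = cong (λ i → suc (suc (i * 3))) (*-cancelʳ-≡ (suc q) (suc j) 2 (suc-injective e))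
... | 3[1+ q ] with marked (suc q)
...   | true = contradiction (sym e) (odd≢even (suc j) (suc q))
...   | false = contradiction (sym e) (odd≢even (suc j) (suc q * 3))

writeTime-positive : ∀ p → 0 < writeTime (suc p)
writeTime-positive p with ternary (suc p)
... | one₃ = s≤s z≤n
... | two₃ = s≤s z≤n
... | 3[1+ q ]+1 = s≤s z≤n
... | 3[1+ q ]+2 = s≤s z≤n
... | 3[1+ q ] with marked (suc q)
...   | true = s≤s z≤n
...   | false = s≤s z≤n

-- `revealed m w` is the content of a cell with write time w once steps
-- 1, …, m have been performed (write time 0 means "never written").
revealed : ℕ → ℕ → Maybe ℕ
revealed m zero = nothing
revealed m (suc w) with suc w ≤? m
... | yes _ = just (suc w)
... | no _ = nothing

revealed-≤ : ∀ m w → 0 < w → w ≤ m → revealed m w ≡ just w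
revealed-≤ m (suc w) _ w≤m with suc w ≤? m
... | yes _ = refl
... | no w≰m = contradiction w≤m w≰m

revealed-> : ∀ m w → m < w → revealed m w ≡ nothing
revealed-> m (suc w) m<w with suc w ≤? m
... | yes w≤m = contradiction w≤m (<⇒≱ m<w)
... | no _ = refl

revealed-zero : ∀ w → revealed 0 w ≡ nothing
revealed-zero zero = refl
revealed-zero (suc w) = refl

revealed-suc : ∀ m w → w ≢ suc m → revealed m w ≡ revealed (suc m) w
revealed-suc m zero _ = refl
revealed-suc m (suc w) w≢1+m with suc w ≤? m | suc w ≤? suc m
... | yes _ | yes _ = refl
... | no _ | no _ = refl
... | yes w≤m | no w≰1+m = contradiction (m≤n⇒m≤1+n w≤m) w≰1+m
... | no w≰m | yes w≤1+m with m≤n⇒m<n∨m≡n w≤1+m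
...   | inj₁ w<1+m = contradiction (≤-pred w<1+m) w≰m
...   | inj₂ w≡1+m = contradiction w≡1+m w≢1+m

_≐_ : State → State → Set
s ≐ t = ∀ p → s p ≡ t p

written : ℕ → State
written m p = revealed m (writeTime p)

assign-here : ∀ s T v → assign s T v T ≡ just v
assign-here s T v with T ≡ᵇ T | ≡⇒≡ᵇ T T refl
... | true | _ = refl

assign-elsewhere : ∀ s T v p → p ≢ T → assign s T v p ≡ s p
assign-elsewhere s T v p p≢T with p ≡ᵇ T | ≡ᵇ⇒≡ p T
... | false | _ = refl
... | true | p≡T = contradiction (p≡T tt) p≢T

assign-written : ∀ m s T → s ≐ written m → writeTime T ≡ suc m →
                 (∀ p → writeTime p ≡ suc m → p ≡ T) →
                 assign s T (suc m) ≐ written (suc m)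
assign-written m s T s≐ wT≡ only p with p ≟ T
... | yes refl = begin
  assign s T (suc m) T          ≡⟨ assign-here s T (suc m) ⟩
  just (suc m)                  ≡⟨ sym (revealed-≤ (suc m) (suc m) (s≤s z≤n) ≤-refl) ⟩
  revealed (suc m) (suc m)      ≡⟨ cong (revealed (suc m)) (sym wT≡) ⟩
  written (suc m) T             ∎
  where open ≡-Reasoning
... | no p≢T = begin
  assign s T (suc m) p          ≡⟨ assign-elsewhere s T (suc m) p p≢T ⟩
  s p                           ≡⟨ s≐ p ⟩
  revealed m (writeTime p)      ≡⟨ revealed-suc m (writeTime p) (λ e → p≢T (only p e)) ⟩
  written (suc m) p             ∎
  where open ≡-Reasoning

stepAt-unassigned : ∀ M s S → M ∸ (M + 1) / 2 ≡ S → s S ≡ nothing → stepAt M s ≐ assign s S M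
stepAt-unassigned M s _ refl free p rewrite free = refl

stepAt-assigned : ∀ M s S T v → M ∸ (M + 1) / 2 ≡ S → M + (M + 1) / 2 ≡ T → s S ≡ just v →
                  stepAt M s ≐ assign s T M
stepAt-assigned M s _ _ v refl refl taken p rewrite taken = refl

half-even : ∀ j → (j * 2 + 1) / 2 ≡ j
half-even zero = refl
half-even (suc j) = trans (m/n≡1+[m∸n]/n {suc (suc (j * 2 + 1))} {2} (s≤s (s≤s z≤n))) (cong suc (half-even j))

half-odd : ∀ j → (suc (j * 2) + 1) / 2 ≡ suc j
half-odd zero = refl
half-odd (suc j) = trans (m/n≡1+[m∸n]/n {suc (suc (suc (j * 2) + 1))} {2} (s≤s (s≤s z≤n))) (cong suc (half-odd j))

even-source : ∀ j → suc j * 2 ∸ (suc j * 2 + 1) / 2 ≡ suc j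
even-source j rewrite half-even (suc j) = trans (cong (_∸ suc j) (identity j)) (m+n∸n≡m (suc j) (suc j))
  where
  identity : ∀ j → suc j * 2 ≡ suc j + suc j
  identity = solve-∀

even-target : ∀ j → suc j * 2 + (suc j * 2 + 1) / 2 ≡ suc j * 3
even-target j rewrite half-even (suc j) = identity j
  where
  identity : ∀ j → suc j * 2 + suc j ≡ suc j * 3
  identity = solve-∀

odd-source : ∀ j → suc (suc j * 2) ∸ (suc (suc j * 2) + 1) / 2 ≡ suc j
odd-source j rewrite half-odd (suc j) = trans (cong (_∸ suc (suc j)) (identity j)) (m+n∸n≡m (suc j) (suc (suc j)))
  where
  identity : ∀ j → suc (suc j * 2) ≡ suc j + suc (suc j)
  identity = solve-∀

odd-target : ∀ j → suc (suc j * 2) + (suc (suc j * 2) + 1) / 2 ≡ suc (suc (suc j * 3))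
odd-target j rewrite half-odd (suc j) = identity j
  where
  identity : ∀ j → suc (suc j * 2) + suc (suc j) ≡ suc (suc (suc j * 3))
  identity = solve-∀

step-writes : ∀ m s T → s ≐ written (suc m) →
              stepAt (suc (suc m)) s ≐ assign s T (suc (suc m)) →
              writeTime T ≡ suc (suc m) → (∀ p → writeTime p ≡ suc (suc m) → p ≡ T) →
              stepAt (suc (suc m)) s ≐ written (suc (suc m))
step-writes m s T s≐ acts wT only p = trans (acts p) (assign-written (suc m) s T s≐ wT only p)

occupied : ∀ m s p → s ≐ written m → writeTime (suc p) ≤ m → s (suc p) ≡ just (writeTime (suc p))
occupied m s p s≐ w≤m = trans (s≐ (suc p)) (revealed-≤ m (writeTime (suc p)) (writeTime-positive p) w≤m)

-- Step 2(j+1) with j+1 unmarked: cell j+1 is still free and gets filled.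
even-step-unmarked : ∀ j s → marked (suc j) ≡ false → s ≐ written (suc (j * 2)) →
                     stepAt (suc j * 2) s ≐ written (suc j * 2)
even-step-unmarked j s mk s≐ =
  step-writes (j * 2) s (suc j) s≐ (stepAt-unassigned (suc j * 2) s (suc j) (even-source j) free)
              (writeTime-unmarked (suc j) mk) only
  where
  free : s (suc j) ≡ nothing
  free = trans (s≐ (suc j)) (trans (cong (revealed (suc (j * 2))) (writeTime-unmarked (suc j) mk))
                                   (revealed-> (suc (j * 2)) (suc j * 2) ≤-refl))
  only : ∀ p → writeTime p ≡ suc j * 2 → p ≡ suc j
  only p e with writeTime≡even j p e
  ... | inj₁ (_ , p≡1+j) = p≡1+j
  ... | inj₂ (mk′ , _) = contradiction (trans (sym mk′) mk) λ ()

-- Step 2(j+1) with j+1 marked: cell j+1 is occupied, so cell 3(j+1) is filled.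
even-step-marked : ∀ j s → marked (suc j) ≡ true → s ≐ written (suc (j * 2)) →
                   stepAt (suc j * 2) s ≐ written (suc j * 2)
even-step-marked j s mk s≐ =
  step-writes (j * 2) s (suc j * 3) s≐
              (stepAt-assigned (suc j * 2) s (suc j) (suc j * 3) _ (even-source j) (even-target j) taken)
              (writeTime-marked-3[1+] j mk) only
  where
  taken : s (suc j) ≡ just (writeTime (suc j))
  taken = occupied (suc (j * 2)) s j s≐ (≤-pred (writeTime-marked-< (suc j) mk))
  only : ∀ p → writeTime p ≡ suc j * 2 → p ≡ suc j * 3
  only p e with writeTime≡even j p e
  ... | inj₁ (mk′ , refl) = contradiction (trans (sym mk′) mk) λ ()
  ... | inj₂ (_ , p≡3[1+j]) = p≡3[1+j]

-- Step 2(j+1)+1: cell j+1 is always occupied, so cell 3(j+1)+2 is filled.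
odd-step : ∀ j s → s ≐ written (suc j * 2) → stepAt (suc (suc j * 2)) s ≐ written (suc (suc j * 2))
odd-step j s s≐ =
  step-writes (suc (j * 2)) s (suc (suc (suc j * 3))) s≐
              (stepAt-assigned (suc (suc j * 2)) s (suc j) _ _ (odd-source j) (odd-target j) taken)
              (writeTime-3[1+]+2 j) (writeTime≡odd j)
  where
  taken : s (suc j) ≡ just (writeTime (suc j))
  taken = occupied (suc j * 2) s j s≐ (writeTime-≤ (suc j))

step-preserves : ∀ m s → s ≐ written (suc m) → stepAt (suc (suc m)) s ≐ written (suc (suc m))
step-preserves m s with parity m
... | odd j = odd-step j s
... | even j with marked (suc j) in mk
...   | false = even-step-unmarked j s mk
...   | true = even-step-marked j s mk

state-closed : ∀ m → state m ≐ written m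
state-closed zero p = sym (revealed-zero (writeTime p))
state-closed (suc zero) = assign-written 0 empty 1 (state-closed 0) refl writeTime≡1
state-closed (suc (suc m)) = step-preserves m (state (suc m)) (state-closed (suc m))

Π₄₂-closed : ∀ p → Π₄₂ (suc p) ≡ just (writeTime (suc p))
Π₄₂-closed p = trans (state-closed (2 * suc p + 1) (suc p))
  (revealed-≤ (2 * suc p + 1) (writeTime (suc p)) (writeTime-positive p) bound)
  where
  bound : writeTime (suc p) ≤ 2 * suc p + 1
  bound = ≤-trans (writeTime-≤ (suc p)) (≤-trans (≤-reflexive (*-comm (suc p) 2)) (m≤m+n (2 * suc p) 1))

typeIV-shape : ∀ {n} (t : Ternary n) → writeTimeᵛ t < n → 3 * writeTimeᵛ t ≡ 2 * n →
               ∃ λ q → n ≡ q * 3 × marked q ≡ true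
typeIV-shape one₃ (s≤s ()) _
typeIV-shape two₃ (s≤s (s≤s ())) _
typeIV-shape 3[1+ q ] lt _ with marked (suc q) in mk
... | true = suc q , refl , mk
... | false = contradiction (m≤m*n (suc q * 3) 2) (<⇒≱ lt)
typeIV-shape 3[1+ q ]+1 lt _ = contradiction (m≤m*n (suc (suc q * 3)) 2) (<⇒≱ lt)
typeIV-shape 3[1+ q ]+2 _ e =
  contradiction (trans (sym (odd-form q)) (trans e (even-form q))) (odd≢even (q * 3 + 4) (suc (suc (suc q * 3))))
  where
  odd-form : ∀ q → 3 * suc (suc q * 2) ≡ suc ((q * 3 + 4) * 2)
  odd-form = solve-∀
  even-form : ∀ q → 2 * suc (suc (suc q * 3)) ≡ suc (suc (suc q * 3)) * 2
  even-form q = *-comm 2 _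

typeIV⇒marked : ∀ n → TypeIV n → ∃ λ q → n ≡ q * 3 × marked q ≡ true
typeIV⇒marked (suc p) (v , Π≡v , lt , e) with just-injective (trans (sym (Π₄₂-closed p)) Π≡v)
... | refl = typeIV-shape (ternary (suc p)) lt e

typeIV⇐marked : ∀ q → marked q ≡ true → TypeIV (q * 3)
typeIV⇐marked (suc q) mk =
  suc q * 2 , trans (Π₄₂-closed (suc (suc (q * 3)))) (cong just (writeTime-marked-3[1+] q mk)) ,
  *-monoʳ-< (suc q) (s≤s (s≤s (s≤s z≤n))) , identity q
  where
  identity : ∀ q → 3 * (suc q * 2) ≡ 2 * (suc q * 3)
  identity = solve-∀

Member : ℕ → Set
Member n = n ≡ 1 ⊎ ∃ λ q → n ≡ q * 3 × marked q ≡ true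

InS⇔Member : ∀ n → InS n ⇔ Member n
InS⇔Member n = mk⇔ to from
  where
  to : InS n → Member n
  to (one n≡1) = inj₁ n≡1
  to (typ4 _ iv) = inj₂ (typeIV⇒marked n iv)
  from : Member n → InS n
  from (inj₁ n≡1) = one n≡1
  from (inj₂ (q , refl , mk)) with typeIV⇐marked q mk
  ... | iv@(_ , _ , v<n , _) = typ4 (≤-trans (s≤s z≤n) v<n) iv

marks : ℕ → ℕ → List Bool
marks a zero = []
marks a (suc n) = marked a ∷ marks (suc a) n

marks-snoc : ∀ a n → marks a (suc n) ≡ marks a n ∷ʳ marked (n + a)
marks-snoc a zero = refl
marks-snoc a (suc n) =
  cong (marked a ∷_) (trans (marks-snoc (suc a) n) (cong (λ i → marks (suc a) n ∷ʳ marked i) (+-suc n a)))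

expandBit : Bool → List Bool
expandBit b = b ∷ false ∷ true ∷ []

expand : List Bool → List Bool
expand = concatMap expandBit

-- Self-similarity of the marks: from 3 on, the window of 3(a+1) is the
-- expansion of the window of a+1, because 3q is marked iff q is, 3q+1 never
-- is, and 3q+2 always is.
expand-marks : ∀ a L → expand (marks (suc a) L) ≡ marks (suc a * 3) (L * 3)
expand-marks a zero = refl
expand-marks a (suc L) = begin
  marked (suc a) ∷ false ∷ true ∷ expand (marks (suc (suc a)) L)
    ≡⟨ cong (λ z → marked (suc a) ∷ false ∷ true ∷ z) (expand-marks (suc a) L) ⟩
  marked (suc a) ∷ false ∷ true ∷ marks (suc (suc a) * 3) (L * 3)
    ≡⟨ cong₂ (λ x y → x ∷ y ∷ true ∷ rest) (sym (marked-3[1+] a)) (sym (marked-3[1+]+1 a)) ⟩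
  marked (suc a * 3) ∷ marked (suc (suc a * 3)) ∷ true ∷ rest
    ≡⟨ cong (λ x → marked (suc a * 3) ∷ marked (suc (suc a * 3)) ∷ x ∷ rest) (sym (marked-3[1+]+2 a)) ⟩
  marks (suc a * 3) (suc L * 3)
    ∎
  where
  open ≡-Reasoning
  rest = marks (suc (suc a) * 3) (L * 3)

-- The number of unmarked positions following a mark coded by each letter:
-- a letter x stands for a mark followed by `gap x` unmarked positions.
gap : Letter → ℕ
gap a1 = 0
gap a2 = 1
gap a3 = 2
gap a4 = 1

width : Letter → ℕ
width x = suc (gap x)

code : Letter → List Bool
code x = true ∷ replicate (gap x) false

codeWord : List Letter → List Bool
codeWord = concatMap code

-- The letters other than 4, on which κ corresponds to `expand` (up to a shift
-- by one mark).
data Ordinary : Letter → Set where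
  ord1 : Ordinary a1
  ord2 : Ordinary a2
  ord3 : Ordinary a3

codeWord-κ : ∀ {x} → Ordinary x → ∀ r → codeWord (κ x) ++ (true ∷ r) ≡ true ∷ expand (code x) ++ r
codeWord-κ ord1 r = refl
codeWord-κ ord2 r = refl
codeWord-κ ord3 r = refl

codeWord-κ* : ∀ v → All Ordinary v → codeWord (κ* v) ++ [ true ] ≡ true ∷ expand (codeWord v)
codeWord-κ* [] [] = refl
codeWord-κ* (x ∷ v) (ox ∷ ov) = begin
  codeWord (κ x ++ κ* v) ++ [ true ]                   ≡⟨ cong (_++ [ true ]) (concatMap-++ code (κ x) (κ* v)) ⟩
  (codeWord (κ x) ++ codeWord (κ* v)) ++ [ true ]      ≡⟨ ++-assoc (codeWord (κ x)) (codeWord (κ* v)) [ true ] ⟩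
  codeWord (κ x) ++ (codeWord (κ* v) ++ [ true ])      ≡⟨ cong (codeWord (κ x) ++_) (codeWord-κ* v ov) ⟩
  codeWord (κ x) ++ (true ∷ expand (codeWord v))       ≡⟨ codeWord-κ ox (expand (codeWord v)) ⟩
  true ∷ expand (code x) ++ expand (codeWord v)        ≡⟨ cong (true ∷_) (sym (concatMap-++ expandBit (code x) (codeWord v))) ⟩
  true ∷ expand (code x ++ codeWord v)                 ∎
  where open ≡-Reasoning

ordinary-κ* : ∀ v → All Ordinary v → All Ordinary (κ* v)
ordinary-κ* [] [] = []
ordinary-κ* (a1 ∷ v) (ord1 ∷ ov) = ord1 ∷ ord2 ∷ ordinary-κ* v ov
ordinary-κ* (a2 ∷ v) (ord2 ∷ ov) = ord1 ∷ ord2 ∷ ord3 ∷ ordinary-κ* v ov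
ordinary-κ* (a3 ∷ v) (ord3 ∷ ov) = ord1 ∷ ord2 ∷ ord3 ∷ ord3 ∷ ordinary-κ* v ov

power-shape : ∀ J → ∃ λ v → κ^ J ≡ a4 ∷ v × All Ordinary v
power-shape zero = [] , refl , []
power-shape (suc J) with power-shape J
... | v , κ^J≡ , ov rewrite κ^J≡ = a2 ∷ a3 ∷ κ* v , refl , ord2 ∷ ord3 ∷ ordinary-κ* v ov

codeWord-power-suc : ∀ J → codeWord (κ^ (suc J)) ++ [ true ] ≡ true ∷ false ∷ expand (codeWord (κ^ J))
codeWord-power-suc J with power-shape J
... | v , κ^J≡ , ov rewrite κ^J≡ =
  cong (λ z → true ∷ false ∷ true ∷ false ∷ true ∷ false ∷ false ∷ z) (codeWord-κ* v ov)

codeWord-power-marks : ∀ J → ∃ λ n → codeWord (κ^ J) ++ [ true ] ≡ marks 1 (suc n)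
codeWord-power-marks zero = 2 , refl
codeWord-power-marks (suc J) with codeWord-power-marks J
... | n , e = suc (n * 3) , (begin
  codeWord (κ^ (suc J)) ++ [ true ]            ≡⟨ codeWord-power-suc J ⟩
  true ∷ false ∷ expand (codeWord (κ^ J))      ≡⟨ cong (λ z → true ∷ false ∷ expand z) code≡marks ⟩
  true ∷ false ∷ expand (marks 1 n)            ≡⟨ cong (λ z → true ∷ false ∷ z) (expand-marks 0 n) ⟩
  marks 1 (suc (suc (n * 3)))                  ∎)
  where
  open ≡-Reasoning
  code≡marks : codeWord (κ^ J) ≡ marks 1 n
  code≡marks = proj₁ (∷ʳ-injective (codeWord (κ^ J)) (marks 1 n) (trans e (marks-snoc 1 n)))

-- Reading a coded word against the marks.  `prefixWidth w t` is the total
-- width of the first t letters of w, i.e. the offset of the (t+1)-st coded mark.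
prefixWidth : List Letter → ℕ → ℕ
prefixWidth w zero = 0
prefixWidth [] (suc t) = 0
prefixWidth (x ∷ w) (suc t) = width x + prefixWidth w t

read-gap : ∀ z b n rest → replicate z false ++ rest ≡ marks b n →
           (∀ i → i < z → marked (i + b) ≡ false) × ∃ λ n′ → rest ≡ marks (z + b) n′
read-gap zero b n rest e = (λ _ ()) , n , e
read-gap (suc z) b (suc n) rest e with ∷-injective e
... | unmarked , e′ with read-gap z (suc b) n rest e′
...   | later , n′ , rest≡ = first , n′ , trans rest≡ (cong (λ c → marks c n′) (+-suc z b))
  where
  first : ∀ i → i < suc z → marked (i + b) ≡ false
  first zero _ = sym unmarked
  first (suc i) (s≤s i<z) = trans (cong marked (sym (+-suc i b))) (later i i<z)

read-letter : ∀ x w a n → codeWord (x ∷ w) ++ [ true ] ≡ marks a n →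
              marked a ≡ true × (∀ i → i < gap x → marked (i + suc a) ≡ false) ×
              ∃ λ n′ → codeWord w ++ [ true ] ≡ marks (width x + a) n′
read-letter x w a n e with n | trans (sym (++-assoc (code x) (codeWord w) [ true ])) e
... | suc n₁ | e′ with ∷-injective e′
...   | head , e″ with read-gap (gap x) (suc a) n₁ _ e″
...     | unmarked , n′ , rest≡ =
  sym head , unmarked , n′ , trans rest≡ (cong (λ c → marks c n′) (+-suc (gap x) a))

shift : ∀ x p a → (x + p) + a ≡ p + (x + a)
shift = solve-∀

decode-marked : ∀ w a n → codeWord w ++ [ true ] ≡ marks a n →
                ∀ t → marked (prefixWidth w t + a) ≡ true
decode-marked [] a (suc n) e zero = sym (∷-injectiveˡ e)
decode-marked [] a (suc n) e (suc t) = sym (∷-injectiveˡ e)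
decode-marked (x ∷ w) a n e zero = proj₁ (read-letter x w a n e)
decode-marked (x ∷ w) a n e (suc t) with read-letter x w a n e
... | _ , _ , n′ , e′ = trans (cong marked (shift (width x) (prefixWidth w t) a))
                              (decode-marked w (width x + a) n′ e′ t)

decode-gap : ∀ w a n → codeWord w ++ [ true ] ≡ marks a n → ∀ t → t < length w →
             ∀ i → i < gap (nth w t) → marked (i + suc (prefixWidth w t + a)) ≡ false
decode-gap (x ∷ w) a n e zero _ = proj₁ (proj₂ (read-letter x w a n e))
decode-gap (x ∷ w) a n e (suc t) (s≤s t<∣w∣) i i<gap with read-letter x w a n e
... | _ , _ , n′ , e′ = trans (cong (λ p → marked (i + suc p)) (shift (width x) (prefixWidth w t) a))
                              (decode-gap w (width x + a) n′ e′ t t<∣w∣ i i<gap)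

-- The words κ^J(4) form a chain of prefixes of unboundedly growing length,
-- so their letters stabilise to those of the fixed point k.
κ^-prefix-step : ∀ J → ∃ λ ys → κ^ (suc J) ≡ κ^ J ++ ys
κ^-prefix-step zero = a2 ∷ a3 ∷ [] , refl
κ^-prefix-step (suc J) with κ^-prefix-step J
... | ys , e = κ* ys , trans (cong κ* e) (concatMap-++ κ (κ^ J) ys)

κ^-prefix : ∀ J d → ∃ λ ys → κ^ (d + J) ≡ κ^ J ++ ys
κ^-prefix J zero = [] , sym (++-identityʳ (κ^ J))
κ^-prefix J (suc d) with κ^-prefix J d | κ^-prefix-step (d + J)
... | ys , e | ys′ , e′ = ys ++ ys′ , trans e′ (trans (cong (_++ ys′) e) (++-assoc (κ^ J) ys ys′))

κ*-length : ∀ v → length v ≤ length (κ* v)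
κ*-length [] = z≤n
κ*-length (x ∷ v) = subst (suc (length v) ≤_) (sym (length-++ (κ x))) (+-mono-≤ (nonempty x) (κ*-length v))
  where
  nonempty : ∀ x → 1 ≤ length (κ x)
  nonempty a1 = s≤s z≤n
  nonempty a2 = s≤s z≤n
  nonempty a3 = s≤s z≤n
  nonempty a4 = s≤s z≤n

κ^-length : ∀ J → J < length (κ^ J)
κ^-length zero = s≤s z≤n
κ^-length (suc J) with power-shape J | κ^-length J
... | v , κ^J≡ , _ | J<∣κ^J∣ rewrite κ^J≡ = s≤s (≤-trans J<∣κ^J∣ (s≤s (m≤n⇒m≤1+n (κ*-length v))))

k-power : ∀ J t → t < J → nth (κ^ J) t ≡ k (suc t)
k-power J t t<J with κ^-prefix (suc t) (J ∸ suc t)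
... | ys , e = begin
  nth (κ^ J) t                              ≡⟨ cong (λ i → nth (κ^ i) t) (sym (m∸n+n≡m t<J)) ⟩
  nth (κ^ (J ∸ suc t + suc t)) t            ≡⟨ cong (λ w → nth w t) e ⟩
  nth (κ^ (suc t) ++ ys) t                  ≡⟨ nth-++ (κ^ (suc t)) ys t (<-trans (n<1+n t) (κ^-length (suc t))) ⟩
  k (suc t)                                 ∎
  where open ≡-Reasoning

-- `markPos t` is the (t+1)-st marked number: 1, then steps of width k(t+1).
markPos : ℕ → ℕ
markPos zero = 1
markPos (suc t) = markPos t + width (k (suc t))

prefixWidth-suc : ∀ w t → t < length w → prefixWidth w (suc t) ≡ prefixWidth w t + width (nth w t)
prefixWidth-suc (x ∷ w) zero _ = +-identityʳ (width x)
prefixWidth-suc (x ∷ w) (suc t) (s≤s t<∣w∣) =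
  trans (cong (width x +_) (prefixWidth-suc w t t<∣w∣)) (sym (+-assoc (width x) _ _))

markPos-prefix : ∀ J t → t ≤ J → markPos t ≡ prefixWidth (κ^ J) t + 1
markPos-prefix J zero _ = refl
markPos-prefix J (suc t) t<J = begin
  markPos t + width (k (suc t))
    ≡⟨ cong₂ _+_ (markPos-prefix J t (<⇒≤ t<J)) (cong width (sym (k-power J t t<J))) ⟩
  prefixWidth (κ^ J) t + 1 + width (nth (κ^ J) t)
    ≡⟨ swap (prefixWidth (κ^ J) t) (width (nth (κ^ J) t)) ⟩
  prefixWidth (κ^ J) t + width (nth (κ^ J) t) + 1
    ≡⟨ cong (_+ 1) (sym (prefixWidth-suc (κ^ J) t (<-trans t<J (κ^-length J)))) ⟩
  prefixWidth (κ^ J) (suc t) + 1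
    ∎
  where
  open ≡-Reasoning
  swap : ∀ p x → p + 1 + x ≡ p + x + 1
  swap = solve-∀

markPos-marked : ∀ t → marked (markPos t) ≡ true
markPos-marked t with codeWord-power-marks t
... | n , e = trans (cong marked (markPos-prefix t t ≤-refl)) (decode-marked (κ^ t) 1 (suc n) e t)

markPos-gap : ∀ t i → i < gap (k (suc t)) → marked (i + suc (markPos t)) ≡ false
markPos-gap t i i<gap with codeWord-power-marks (suc t)
... | n , e = trans (cong (λ p → marked (i + suc p)) (markPos-prefix (suc t) t (n≤1+n t)))
                    (decode-gap (κ^ (suc t)) 1 (suc n) e t (<-trans (n<1+n t) (κ^-length (suc t))) i
                                (subst (λ x → i < gap x) (sym (k-power (suc t) t ≤-refl)) i<gap))

markPos-increasing : ∀ t → markPos t < markPos (suc t)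
markPos-increasing t = m<m+n (markPos t) (s≤s z≤n)

markPos-gaps : ∀ t d → markPos t < d → d < markPos (suc t) → ¬ (marked d ≡ true)
markPos-gaps t d p<d d<p′ mk =
  contradiction (trans (sym (markPos-gap t i i<gap)) (trans (cong marked d≡) mk)) λ ()
  where
  p = markPos t
  i = d ∸ suc p
  d≡ : i + suc p ≡ d
  d≡ = m∸n+n≡m p<d
  G = gap (k (suc t))
  d≤G+p : d ≤ G + p
  d≤G+p = subst (d ≤_) (+-comm p G) (≤-pred (subst (d <_) (+-suc p G) d<p′))
  i<gap : i < G
  i<gap = +-cancelʳ-< p i G (subst (_≤ G + p) (trans (sym d≡) (+-suc i p)) d≤G+p)

every-mark : ∀ q → marked q ≡ true → ∃ λ t → markPos t ≡ q
every-mark zero ()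
every-mark (suc q) mk =
  gapless-enumeration markPos (λ d → marked d ≡ true) markPos-increasing markPos-gaps (suc q) (s≤s z≤n) mk

I : ℕ → ℕ
I zero = 0
I (suc zero) = 1
I (suc (suc t)) = markPos t * 3

I-step : ∀ i → 1 ≤ i → I i < I (suc i)
I-step (suc zero) _ = s≤s (s≤s z≤n)
I-step (suc (suc t)) _ = *-monoˡ-< 3 (markPos-increasing t)

I-range : ∀ n → (∃ λ j → 1 ≤ j × I j ≡ n) ⇔ Member n
I-range n = mk⇔ to from
  where
  to : (∃ λ j → 1 ≤ j × I j ≡ n) → Member n
  to (suc zero , _ , refl) = inj₁ refl
  to (suc (suc t) , _ , refl) = inj₂ (markPos t , refl , markPos-marked t)
  from : Member n → ∃ λ j → 1 ≤ j × I j ≡ n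
  from (inj₁ refl) = 1 , s≤s z≤n , refl
  from (inj₂ (q , refl , mk)) with every-mark q mk
  ... | t , markPos≡q = suc (suc t) , s≤s z≤n , cong (_* 3) markPos≡q

λ≡3width : ∀ x → lam x ≡ width x * 3
λ≡3width a1 = refl
λ≡3width a2 = refl
λ≡3width a3 = refl
λ≡3width a4 = refl

I-gap : ∀ n → 1 ≤ n → I (n + 2) ∸ I (n + 1) ≡ lam (k n)
I-gap (suc t) _ rewrite +-comm t 2 | +-comm t 1 = begin
  (markPos t + width (k (suc t))) * 3 ∸ markPos t * 3         ≡⟨ cong (_∸ markPos t * 3) (*-distribʳ-+ 3 (markPos t) _) ⟩
  markPos t * 3 + width (k (suc t)) * 3 ∸ markPos t * 3       ≡⟨ m+n∸m≡n (markPos t * 3) _ ⟩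
  width (k (suc t)) * 3                                        ≡⟨ sym (λ≡3width (k (suc t))) ⟩
  lam (k (suc t))                                              ∎
  where open ≡-Reasoning

proposition6 : ∃ λ (I : ℕ → ℕ) →
    (∀ i j → 1 ≤ i → i < j → I i < I j)
    × (∀ n → InS n ⇔ (∃ λ j → 1 ≤ j × I j ≡ n))
    × (∀ n → 1 ≤ n → I (n + 2) ∸ I (n + 1) ≡ lam (k n))
proposition6 =
  I ,
  stepwise-increasing I 1 I-step ,
  (λ n → ⇔-trans (InS⇔Member n) (⇔-sym (I-range n))) ,
  I-gap
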